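{- Let $c\ge 2$ be an integer. For every integer $d\ge 1$ there exists a $c$-edge-colored undirected graph $G$ with $\delta_{mon}(G)=d$ that has no properly colored cycle.
   Context: All graphs are simple (no loops, no parallel edges). A $c$-edge-colored graph is a graph $G=(V,E)$ together with a fixed, not necessarily proper, edge-coloring $\chi:E\to\{1,\dots,c\}$. A subgraph $H$ of $G$ is properly colored if no vertex of $H$ is incident to two edges of $H$ of the same color. For a vertex $x$, $d_i(x)$ is the number of edges of color $i$ incident with $x$, and $\delta_{mon}(G)=\min\{d_i(x): x\in V(G),\ i\in\{1,\dots,c\}\}$. -}

module Defs where

open import Data.Nat using (ℕ; zero; suc; _+_; _≤_)
open import Data.Nat.DivMod using (_mod_)
open import Data.Fin using (Fin; toℕ)
open import Data.Fin.Properties using () renaming (_≟_ to _≟F_)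
open import Data.Maybe using (Maybe; just; nothing)
open import Data.Maybe.Properties using (≡-dec)
open import Data.List using (List; []; _∷_; allFin)
open import Data.Product using (Σ; _×_; ∃)
open import Function.Definitions using (Injective)
open import Relation.Binary.PropositionalEquality using (_≡_; _≢_)
open import Relation.Nullary using (¬_; yes; no)

-- A c-edge-colored simple graph on the vertex set Fin n.
-- colour x y ≡ nothing  : x and y are not adjacent
-- colour x y ≡ just i   : xy is an edge of colour i (colours are Fin c, i.e. c colours)
-- Symmetry and irreflexivity make this a simple undirected graph with a
-- (not necessarily proper) edge-colouring.
record ColoredGraph (c : ℕ) : Set where
  field
    n      : ℕ
    colour : Fin n → Fin n → Maybe (Fin c)
    sym    : ∀ x y → colour x y ≡ colour y x
    irrefl : ∀ x → colour x x ≡ nothing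
open ColoredGraph public

countEq : {c : ℕ} → Maybe (Fin c) → List (Maybe (Fin c)) → ℕ
countEq a [] = 0
countEq a (b ∷ bs) with ≡-dec _≟F_ b a
... | yes _ = suc (countEq a bs)
... | no  _ = countEq a bs

colourDegree : {c : ℕ} (G : ColoredGraph c) → Fin c → Fin (n G) → ℕ
colourDegree G i x = countEq (just i) (Data.List.map (colour G x) (allFin (n G)))

MinMonoDegreeIs : {c : ℕ} → ColoredGraph c → ℕ → Set
MinMonoDegreeIs G d =
  (∀ (x : Fin (n G)) (i : Fin _) → d ≤ colourDegree G i x)
  × Σ (Fin (n G)) (λ x → Σ (Fin _) (λ i → colourDegree G i x ≡ d))

next : {m : ℕ} → Fin (3 + m) → Fin (3 + m)
next {m} j = suc (toℕ j) mod (3 + m)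

ProperlyColouredCycle : {c : ℕ} → ColoredGraph c → Set
ProperlyColouredCycle G =
  Σ ℕ λ m → Σ (Fin (3 + m) → Fin (n G)) λ v →
    Injective _≡_ _≡_ v
    × (∀ j → colour G (v j) (v (next j)) ≢ nothing)
    × (∀ j → colour G (v j) (v (next j)) ≢ colour G (v (next j)) (v (next (next j))))

-- Take as vertices the words over the c colours in which every colour occurs
-- at most d times, and join two words when one is a proper prefix of the
-- other, colouring the edge by the letter that follows the prefix. The
-- j-neighbours of w are its prefixes followed by j (one per occurrence of j in
-- w) and its extensions w j s; so d_j(w) ≥ d, with equality for w = 0^d.
-- In a cycle, let u be a shortest vertex and i the colour of the edge from u
-- to its successor. A neighbour of an extension u i s that is not shorter than
-- u is u itself or again an extension u i s′, so going around the cycle every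
-- vertex is u or some u i s, and both cycle edges at u have colour i.
module Submission where

open import Defs hiding (sym)
open import Data.Nat using (ℕ; zero; suc; pred; _+_; _*_; _∸_; _≤_; _<_; s≤s; z≤n; s≤s⁻¹)
open import Data.Nat.Properties
open import Data.Nat.DivMod using (_%_; m%n<n; m<n⇒m%n≡m; n%n≡0)
open import Data.Fin using (Fin; zero; suc; toℕ; fromℕ; inject₁)
open import Data.Fin.Properties using (toℕ-injective; toℕ-fromℕ; toℕ-fromℕ<; toℕ-inject₁; toℕ<n; toℕ≤pred[n]) renaming (_≟_ to _≟F_)
open import Data.Maybe using (Maybe; just; nothing)
open import Data.Maybe.Properties using (≡-dec; just-injective)
open import Data.List using (List; []; _∷_; _++_; map; length; allFin; replicate; lookup; tabulate)
open import Data.List.Properties using (∷-injectiveʳ; ∷-injectiveˡ; map-++; map-∘; map-cong; length-map; length-++; map-tabulate; tabulate-lookup) renaming (≡-dec to ≡-decᴸ)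
open import Data.List.Membership.Propositional using (_∈_)
open import Data.List.Membership.Propositional.Properties using (∈-map⁺; ∈-map⁻; ∈-++⁺ˡ; ∈-++⁺ʳ; ∈-++⁻; ∈-allFin; ∈-lookup)
open import Data.List.Relation.Unary.Any using (here; there; index)
open import Data.List.Relation.Unary.Any.Properties using (lookup-index)
open import Data.List.Relation.Unary.All as All using ([])
open import Data.List.Relation.Unary.AllPairs using ([]; _∷_)
open import Data.List.Relation.Unary.Unique.Propositional using (Unique)
open import Data.List.Relation.Unary.Unique.Propositional.Properties using (++⁺; map⁺; allFin⁺)
open import Data.Vec.Functional using (Vector; foldr; updateAt)
open import Data.Vec.Functional.Properties using (updateAt-updates; updateAt-minimal)
open import Data.Product using (Σ; ∃; _×_; _,_)
open import Data.Sum using (_⊎_; inj₁; inj₂)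
open import Data.Empty using (⊥; ⊥-elim)
open import Function using (_∘_)
open import Function.Definitions using (Injective)
open import Relation.Nullary using (¬_; Dec; yes; no)
open import Relation.Binary.PropositionalEquality

toℕ-next : ∀ {m} (j : Fin (3 + m)) → toℕ (next j) ≡ suc (toℕ j) % (3 + m)
toℕ-next {m} j = toℕ-fromℕ< (m%n<n (suc (toℕ j)) (3 + m))

next-inject₁ : ∀ {m} (j : Fin (2 + m)) → next (inject₁ j) ≡ suc j
next-inject₁ {m} j = toℕ-injective (begin
  toℕ (next (inject₁ j))          ≡⟨ toℕ-next (inject₁ j) ⟩
  suc (toℕ (inject₁ j)) % (3 + m) ≡⟨ cong (λ x → suc x % (3 + m)) (toℕ-inject₁ j) ⟩
  suc (toℕ j) % (3 + m)           ≡⟨ m<n⇒m%n≡m (s≤s (toℕ<n j)) ⟩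
  suc (toℕ j)                     ∎)
  where open ≡-Reasoning

next-fromℕ : ∀ {m} → next (fromℕ (2 + m)) ≡ zero
next-fromℕ {m} = toℕ-injective (begin
  toℕ (next (fromℕ (2 + m)))          ≡⟨ toℕ-next (fromℕ (2 + m)) ⟩
  suc (toℕ (fromℕ (2 + m))) % (3 + m) ≡⟨ cong (λ x → suc x % (3 + m)) (toℕ-fromℕ (2 + m)) ⟩
  (3 + m) % (3 + m)                   ≡⟨ n%n≡0 (3 + m) ⟩
  0                                   ∎)
  where open ≡-Reasoning

next-surjective : ∀ {m} (k : Fin (3 + m)) → ∃ λ p → next p ≡ k
next-surjective zero    = fromℕ _ , next-fromℕ
next-surjective (suc k) = inject₁ k , next-inject₁ k

module _ {m : ℕ} (Q : Fin (3 + m) → Set) (Q-next : ∀ j → Q j → Q (next j)) where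

  private
    next-closed⇒above : ∀ {k} → Q k → ∀ t j → toℕ j ≡ toℕ k + t → Q j
    next-closed⇒above qk zero j j≡k = subst Q (sym (toℕ-injective (trans j≡k (+-identityʳ _)))) qk
    next-closed⇒above {k} qk (suc t) zero j≡k+t with () ← trans j≡k+t (+-suc (toℕ k) t)
    next-closed⇒above {k} qk (suc t) (suc j) j≡k+t = subst Q (next-inject₁ j)
      (Q-next (inject₁ j) (next-closed⇒above qk t (inject₁ j)
        (trans (toℕ-inject₁ j) (suc-injective (trans j≡k+t (+-suc (toℕ k) t))))))

  next-closed⇒all : ∀ {k} → Q k → ∀ j → Q j
  next-closed⇒all {k} qk j = next-closed⇒above q₀ (toℕ j) j refl
    where
    q₀ : Q zero
    q₀ = subst Q next-fromℕ (Q-next _ (next-closed⇒above qk (2 + m ∸ toℕ k) (fromℕ (2 + m))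
           (trans (toℕ-fromℕ (2 + m)) (sym (m+[n∸m]≡n (toℕ≤pred[n] k))))))

argmin : ∀ {n} (f : Fin (suc n) → ℕ) → ∃ λ k → ∀ j → f k ≤ f j
argmin {zero}  f = zero , λ { zero → ≤-refl }
argmin {suc n} f with argmin (f ∘ suc)
... | k , min with f zero ≤? f (suc k)
... | yes f0≤ = zero , λ { zero → ≤-refl ; (suc j) → ≤-trans f0≤ (min j) }
... | no  f0≰ = suc k , λ { zero → <⇒≤ (≰⇒> f0≰) ; (suc j) → min j }

-- The prefix graph on words

Word : ℕ → Set
Word c = List (Fin c)

prefixColour : ∀ {c} → Word c → Word c → Maybe (Fin c)
prefixColour []      []      = nothing
prefixColour []      (b ∷ _) = just b
prefixColour (a ∷ _) []      = just a
prefixColour (a ∷ u) (b ∷ v) with a ≟F b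
... | yes _ = prefixColour u v
... | no  _ = nothing

Extends : ∀ {c} → Word c → Fin c → Word c → Set
Extends u i x = ∃ λ s → x ≡ u ++ i ∷ s

module _ {c : ℕ} where

  prefixColour-sym : (u v : Word c) → prefixColour u v ≡ prefixColour v u
  prefixColour-sym []      []      = refl
  prefixColour-sym []      (b ∷ v) = refl
  prefixColour-sym (a ∷ u) []      = refl
  prefixColour-sym (a ∷ u) (b ∷ v) with a ≟F b | b ≟F a
  ... | yes _   | yes _   = prefixColour-sym u v
  ... | yes a≡b | no  b≢a = ⊥-elim (b≢a (sym a≡b))
  ... | no  a≢b | yes b≡a = ⊥-elim (a≢b (sym b≡a))
  ... | no  _   | no  _   = refl

  prefixColour-irrefl : (u : Word c) → prefixColour u u ≡ nothing
  prefixColour-irrefl []      = refl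
  prefixColour-irrefl (a ∷ u) with a ≟F a
  ... | yes _ = prefixColour-irrefl u
  ... | no  _ = refl

  prefixColour-∷ : ∀ a (u v : Word c) → prefixColour (a ∷ u) (a ∷ v) ≡ prefixColour u v
  prefixColour-∷ a u v with a ≟F a
  ... | yes _   = refl
  ... | no  a≢a = ⊥-elim (a≢a refl)

  prefixColour-∷-≢ : ∀ {a b} (u v : Word c) → a ≢ b → prefixColour (a ∷ u) (b ∷ v) ≡ nothing
  prefixColour-∷-≢ {a} {b} u v a≢b with a ≟F b
  ... | yes a≡b = ⊥-elim (a≢b a≡b)
  ... | no  _   = refl

  prefixColour-extension : ∀ (u : Word c) i s → prefixColour u (u ++ i ∷ s) ≡ just i
  prefixColour-extension []      i s = refl
  prefixColour-extension (a ∷ u) i s = trans (prefixColour-∷ a u (u ++ i ∷ s)) (prefixColour-extension u i s)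

  adjacent-not-shorter⇒extends : ∀ (u x : Word c) {i} → prefixColour u x ≡ just i →
                                 length u ≤ length x → Extends u i x
  adjacent-not-shorter⇒extends []      []      ()  _
  adjacent-not-shorter⇒extends []      (b ∷ s) refl _ = s , refl
  adjacent-not-shorter⇒extends (a ∷ u) []      _   ()
  adjacent-not-shorter⇒extends (a ∷ u) (b ∷ x) col u≤x with a ≟F b
  ... | yes refl = let s , x≡ = adjacent-not-shorter⇒extends u x col (s≤s⁻¹ u≤x) in s , cong (a ∷_) x≡
  adjacent-not-shorter⇒extends (a ∷ u) (b ∷ x) () u≤x | no _

  extension-neighbour-extends : ∀ (u : Word c) {i} s y → prefixColour (u ++ i ∷ s) y ≢ nothing →
                                length u ≤ length y → y ≢ u → Extends u i y
  extension-neighbour-extends []      s []      _   _ y≢u = ⊥-elim (y≢u refl)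
  extension-neighbour-extends []      {i} s (b ∷ y) adj _ _ with i ≟F b
  ... | yes refl = y , refl
  ... | no  _    = ⊥-elim (adj refl)
  extension-neighbour-extends (a ∷ u) s []      _   () _
  extension-neighbour-extends (a ∷ u) s (b ∷ y) adj u≤y y≢u with a ≟F b
  ... | yes refl = let s′ , y≡ = extension-neighbour-extends u s y adj (s≤s⁻¹ u≤y) (y≢u ∘ cong (a ∷_))
                   in s′ , cong (a ∷_) y≡
  ... | no  _    = ⊥-elim (adj refl)

  words-noProperCycle : ∀ m (W : Fin (3 + m) → Word c) → Injective _≡_ _≡_ W →
    (∀ j → prefixColour (W j) (W (next j)) ≢ nothing) →
    (∀ j → prefixColour (W j) (W (next j)) ≢ prefixColour (W (next j)) (W (next (next j)))) →
    ⊥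
  words-noProperCycle m W W-injective adjacent proper
    with argmin (length ∘ W)
  ... | k , shortest with prefixColour (W k) (W (next k)) in colour-k
  ... | nothing = adjacent k colour-k
  ... | just i  = contradiction-at-predecessor
    where
    open ≡-Reasoning
    u : Word c
    u = W k

    Q : Fin (3 + m) → Set
    Q j = W j ≡ u ⊎ Extends u i (W j)

    Q-next : ∀ j → Q j → Q (next j)
    Q-next j (inj₁ Wj≡u) = inj₂ (subst (λ t → Extends u i (W (next t))) (sym (W-injective Wj≡u))
      (adjacent-not-shorter⇒extends u (W (next k)) colour-k (shortest (next k))))
    Q-next j (inj₂ (s , Wj≡)) with ≡-decᴸ _≟F_ (W (next j)) u
    ... | yes W≡u = inj₁ W≡u
    ... | no  W≢u = inj₂ (extension-neighbour-extends u s (W (next j))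
            (adjacent j ∘ trans (cong (λ t → prefixColour t (W (next j))) Wj≡)) (shortest (next j)) W≢u)

    contradiction-at-predecessor : ⊥
    contradiction-at-predecessor with next-surjective k
    ... | p , next-p≡k with next-closed⇒all Q Q-next (inj₁ refl) p
    ... | inj₁ Wp≡u = adjacent k (begin
      prefixColour u (W (next k)) ≡⟨ cong (prefixColour u ∘ W) (trans (cong next (sym (W-injective Wp≡u))) next-p≡k) ⟩
      prefixColour u u            ≡⟨ prefixColour-irrefl u ⟩
      nothing                     ∎)
    ... | inj₂ (s , Wp≡) = proper p (begin
      prefixColour (W p) (W (next p))              ≡⟨ cong (prefixColour (W p) ∘ W) next-p≡k ⟩
      prefixColour (W p) u                         ≡⟨ prefixColour-sym (W p) u ⟩
      prefixColour u (W p)                         ≡⟨ cong (prefixColour u) Wp≡ ⟩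
      prefixColour u (u ++ i ∷ s)                  ≡⟨ prefixColour-extension u i s ⟩
      just i                                       ≡⟨ colour-k ⟨
      prefixColour u (W (next k))                  ≡⟨ cong (λ t → prefixColour (W t) (W (next t))) next-p≡k ⟨
      prefixColour (W (next p)) (W (next (next p))) ∎)

lookup-injective : ∀ {A : Set} {L : List A} → Unique L → Injective _≡_ _≡_ (lookup L)
lookup-injective {L = _ ∷ _} (_ ∷ _)        {zero}  {zero}  _ = refl
lookup-injective {L = _ ∷ _} (x∉L ∷ _)      {zero}  {suc j} e = ⊥-elim (All.lookup x∉L (∈-lookup j) e)
lookup-injective {L = _ ∷ _} (x∉L ∷ _)      {suc i} {zero}  e = ⊥-elim (All.lookup x∉L (∈-lookup i) (sym e))
lookup-injective {L = _ ∷ _} (_ ∷ L-unique) {suc i} {suc j} e = cong suc (lookup-injective L-unique e)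

map-lookup-allFin : ∀ {A B : Set} (f : A → B) (L : List A) → map (f ∘ lookup L) (allFin (length L)) ≡ map f L
map-lookup-allFin f L = begin
  map (f ∘ lookup L) (allFin (length L)) ≡⟨ map-tabulate (λ i → i) (f ∘ lookup L) ⟩
  tabulate (f ∘ lookup L)                ≡⟨ map-tabulate (lookup L) f ⟨
  map f (tabulate (lookup L))            ≡⟨ cong (map f) (tabulate-lookup L) ⟩
  map f L                                ∎
  where open ≡-Reasoning

prefixGraph : ∀ {c} → List (Word c) → ColoredGraph c
prefixGraph L = record
  { n      = length L
  ; colour = λ x y → prefixColour (lookup L x) (lookup L y)
  ; sym    = λ x y → prefixColour-sym (lookup L x) (lookup L y)
  ; irrefl = λ x → prefixColour-irrefl (lookup L x)
  }

prefixGraph-noProperCycle : ∀ {c} (L : List (Word c)) → Unique L → ¬ ProperlyColouredCycle (prefixGraph L)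
prefixGraph-noProperCycle L L-unique (m , v , v-injective , adjacent , proper) =
  words-noProperCycle m (lookup L ∘ v) (v-injective ∘ lookup-injective L-unique) adjacent proper

degree : ∀ {c} → Fin c → Word c → List (Word c) → ℕ
degree j w L = countEq (just j) (map (prefixColour w) L)

colourDegree-prefixGraph : ∀ {c} (L : List (Word c)) j x →
                           colourDegree (prefixGraph L) j x ≡ degree j (lookup L x) L
colourDegree-prefixGraph L j x = cong (countEq (just j)) (map-lookup-allFin (prefixColour (lookup L x)) L)

total : ∀ {n} → Vector ℕ n → ℕ
total = foldr _+_ 0

spend : ∀ {n} → Vector ℕ n → Fin n → Vector ℕ n
spend b a = updateAt b a pred

entry≤total : ∀ {n} (b : Vector ℕ n) j → b j ≤ total b
entry≤total b zero    = m≤m+n _ _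
entry≤total b (suc j) = ≤-trans (entry≤total (b ∘ suc) j) (m≤n+m _ _)

total-spend : ∀ {n} (b : Vector ℕ n) a {k} → b a ≡ suc k → total b ≡ suc (total (spend b a))
total-spend b zero    ba≡ = trans (cong (_+ total (b ∘ suc)) ba≡) (cong (λ x → suc (pred x + total (b ∘ suc))) (sym ba≡))
total-spend b (suc a) ba≡ = trans (cong (b zero +_) (total-spend (b ∘ suc) a ba≡)) (+-suc _ _)

total-spend-≤ : ∀ {n N} (b : Vector ℕ n) a {k} → b a ≡ suc k → total b ≤ suc N → total (spend b a) ≤ N
total-spend-≤ {N = N} b a ba≡ total≤ = s≤s⁻¹ (subst (_≤ suc N) (total-spend b a ba≡) total≤)

spend-self : ∀ {n} (b : Vector ℕ n) a {k} → b a ≡ suc k → spend b a a ≡ k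
spend-self b a ba≡ = trans (updateAt-updates a b) (cong pred ba≡)

spend-other : ∀ {n} (b : Vector ℕ n) a i → i ≢ a → spend b a i ≡ b i
spend-other b a i i≢a = updateAt-minimal i a b i≢a

indicator : ∀ {c} → Fin c → Fin c → ℕ
indicator a j = countEq (just j) (just a ∷ [])

module _ {c : ℕ} where

  indicator-refl : (a : Fin c) → indicator a a ≡ 1
  indicator-refl a with ≡-dec _≟F_ (just a) (just a)
  ... | yes _   = refl
  ... | no  a≢a = ⊥-elim (a≢a refl)

  indicator-≢ : {a j : Fin c} → a ≢ j → indicator a j ≡ 0
  indicator-≢ {a} {j} a≢j with ≡-dec _≟F_ (just a) (just j)
  ... | yes a≡j = ⊥-elim (a≢j (just-injective a≡j))
  ... | no  _   = refl

  indicator+spend : ∀ (b : Vector ℕ c) a j {k} → b a ≡ suc k → indicator a j + spend b a j ≡ b j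
  indicator+spend b a j ba≡ = by-cases (a ≟F j)
    where
    by-cases : Dec (a ≡ j) → indicator a j + spend b a j ≡ b j
    by-cases (yes refl) = trans (cong₂ _+_ (indicator-refl a) (spend-self b a ba≡)) (sym ba≡)
    by-cases (no  a≢j)  = cong₂ _+_ (indicator-≢ a≢j) (spend-other b a j (a≢j ∘ sym))

  countEq-++ : ∀ (x : Maybe (Fin c)) xs ys → countEq x (xs ++ ys) ≡ countEq x xs + countEq x ys
  countEq-++ x []       ys = refl
  countEq-++ x (y ∷ xs) ys with ≡-dec _≟F_ y x
  ... | yes _ = cong suc (countEq-++ x xs ys)
  ... | no  _ = countEq-++ x xs ys

  countEq-∷ : ∀ (j a : Fin c) xs → countEq (just j) (just a ∷ xs) ≡ indicator a j + countEq (just j) xs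
  countEq-∷ j a = countEq-++ (just j) (just a ∷ [])

  countEq-nothing : ∀ {A : Set} (j : Fin c) (X : List A) → countEq (just j) (map (λ _ → nothing) X) ≡ 0
  countEq-nothing j []      = refl
  countEq-nothing j (_ ∷ X) = countEq-nothing j X

  countEq-just : ∀ {A : Set} (j a : Fin c) (X : List A) → countEq (just j) (map (λ _ → just a) X) ≡ indicator a j * length X
  countEq-just j a []      = sym (*-zeroʳ (indicator a j))
  countEq-just j a (_ ∷ X) = trans (countEq-∷ j a _) (trans (cong (indicator a j +_) (countEq-just j a X)) (sym (*-suc (indicator a j) (length X))))

  letterCount : Fin c → Word c → ℕ
  letterCount j w = countEq (just j) (map just w)

  letterCount-replicate : ∀ (j : Fin c) k → letterCount j (replicate k j) ≡ k
  letterCount-replicate j zero    = refl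
  letterCount-replicate j (suc k) = trans (countEq-∷ j j _) (cong₂ _+_ (indicator-refl j) (letterCount-replicate j k))

  degree-++ : ∀ j w (L L′ : List (Word c)) → degree j w (L ++ L′) ≡ degree j w L + degree j w L′
  degree-++ j w L L′ = trans (cong (countEq (just j)) (map-++ (prefixColour w) L L′)) (countEq-++ (just j) (map (prefixColour w) L) _)

  degree-∷-map-∷ : ∀ j a w (X : List (Word c)) → degree j (a ∷ w) (map (a ∷_) X) ≡ degree j w X
  degree-∷-map-∷ j a w X = cong (countEq (just j)) (trans (sym (map-∘ X)) (map-cong (prefixColour-∷ a w) X))

  degree-∷-map-∷-≢ : ∀ j {a b} w (X : List (Word c)) → a ≢ b → degree j (a ∷ w) (map (b ∷_) X) ≡ 0
  degree-∷-map-∷-≢ j w X a≢b = trans (cong (countEq (just j))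
    (trans (sym (map-∘ X)) (map-cong (λ y → prefixColour-∷-≢ w y a≢b) X))) (countEq-nothing j X)

  degree-[]-map-∷ : ∀ j b (X : List (Word c)) → degree j [] (map (b ∷_) X) ≡ indicator b j * length X
  degree-[]-map-∷ j b X = trans (cong (countEq (just j)) (sym (map-∘ X))) (countEq-just j b X)

-- Words within a budget

module _ {c : ℕ} where

  -- words N b lists the words using each letter a at most b a times, once
  -- total b ≤ N (N is only fuel). The last argument of branch is always b a.
  mutual
    words : ℕ → Vector ℕ c → List (Word c)
    words zero    b = [] ∷ []
    words (suc N) b = [] ∷ branches N b (allFin c)

    branches : ℕ → Vector ℕ c → List (Fin c) → List (Word c)
    branches N b []       = []
    branches N b (a ∷ as) = branch N b a (b a) ++ branches N b as

    branch : ℕ → Vector ℕ c → Fin c → ℕ → List (Word c)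
    branch N b a zero    = []
    branch N b a (suc _) = map (a ∷_) (words N (spend b a))

  ∈-branch⁻ : ∀ N b a k {x} → x ∈ branch N b a k →
              ∃ λ w → x ≡ a ∷ w × (∃ λ k′ → k ≡ suc k′) × w ∈ words N (spend b a)
  ∈-branch⁻ N b a (suc k′) x∈ with ∈-map⁻ _ x∈
  ... | w , w∈ , x≡ = w , x≡ , (k′ , refl) , w∈

  ∈-branches⁻ : ∀ N b as {x} → x ∈ branches N b as → ∃ λ a → a ∈ as × x ∈ branch N b a (b a)
  ∈-branches⁻ N b (a ∷ as) x∈ with ∈-++⁻ (branch N b a (b a)) x∈
  ... | inj₁ x∈branch   = a , here refl , x∈branch
  ... | inj₂ x∈branches = let a′ , a′∈ , x∈′ = ∈-branches⁻ N b as x∈branches in a′ , there a′∈ , x∈′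

  ∈-branches⁺ : ∀ N b {a as x} → a ∈ as → x ∈ branch N b a (b a) → x ∈ branches N b as
  ∈-branches⁺ N b (here refl) x∈ = ∈-++⁺ˡ x∈
  ∈-branches⁺ N b {as = a′ ∷ _} (there a∈) x∈ = ∈-++⁺ʳ (branch N b a′ (b a′)) (∈-branches⁺ N b a∈ x∈)

  ∷∈words⁻ : ∀ N b {a w} → a ∷ w ∈ words (suc N) b → (∃ λ k → b a ≡ suc k) × w ∈ words N (spend b a)
  ∷∈words⁻ N b (there aw∈) with ∈-branches⁻ N b (allFin c) aw∈
  ... | a′ , _ , aw∈′ with ∈-branch⁻ N b a′ (b a′) aw∈′
  ... | _ , refl , ba≡ , w∈ = ba≡ , w∈

  replicate∈words : ∀ {N b} j k → k ≤ b j → k ≤ N → replicate k j ∈ words N b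
  replicate∈words {zero}  j zero _ _ = here refl
  replicate∈words {suc N} j zero _ _ = here refl
  replicate∈words {suc N} {b} j (suc k) k<bj k<N with b j in bj≡
  ... | suc _ = there (∈-branches⁺ N b (∈-allFin j) (subst (λ t → _ ∈ branch N b j t) (sym bj≡)
      (∈-map⁺ (j ∷_) (replicate∈words j k (subst (k ≤_) (sym (spend-self b j bj≡)) (s≤s⁻¹ k<bj)) (s≤s⁻¹ k<N)))))

  length-branch≤length-branches : ∀ {N b a as} → a ∈ as → length (branch N b a (b a)) ≤ length (branches N b as)
  length-branch≤length-branches {N} {b} {a} (here refl) =
    subst (length (branch N b a (b a)) ≤_) (sym (length-++ (branch N b a (b a)))) (m≤m+n _ _)
  length-branch≤length-branches {N} {b} {a} {a′ ∷ _} (there a∈) =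
    subst (length (branch N b a (b a)) ≤_) (sym (length-++ (branch N b a′ (b a′))))
      (≤-trans (length-branch≤length-branches a∈) (m≤n+m _ _))

  -- The words [], j, jj, …, j^(b j) are all there.
  budget<length-words : ∀ N b j → b j ≤ N → b j < length (words N b)
  budget<length-words zero    b j bj≤0 = s≤s bj≤0
  budget<length-words (suc N) b j bj≤N with b j in bj≡
  ... | zero  = s≤s z≤n
  ... | suc k = s≤s (begin-strict
    k                                       ≡⟨ spend-self b j bj≡ ⟨
    spend b j j                             <⟨ budget<length-words N (spend b j) j (subst (_≤ N) (sym (spend-self b j bj≡)) (s≤s⁻¹ bj≤N)) ⟩
    length (words N (spend b j))            ≡⟨ length-map (j ∷_) (words N (spend b j)) ⟨
    length (branch N b j (suc k))           ≡⟨ cong (length ∘ branch N b j) bj≡ ⟨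
    length (branch N b j (b j))             ≤⟨ length-branch≤length-branches (∈-allFin j) ⟩
    length (branches N b (allFin c))        ∎)
    where open ≤-Reasoning

  mutual
    words-unique : ∀ N b → Unique (words N b)
    words-unique zero    b = [] ∷ []
    words-unique (suc N) b = All.tabulate []∉branches ∷ branches-unique N b (allFin⁺ c)
      where
      []∉branches : ∀ {x} → x ∈ branches N b (allFin c) → [] ≢ x
      []∉branches x∈ with ∈-branches⁻ N b (allFin c) x∈
      ... | a , _ , x∈branch with ∈-branch⁻ N b a (b a) x∈branch
      ... | _ , refl , _ = λ ()

    branch-unique : ∀ N b a k → Unique (branch N b a k)
    branch-unique N b a zero    = []
    branch-unique N b a (suc _) = map⁺ ∷-injectiveʳ (words-unique N (spend b a))

    branches-unique : ∀ N b {as} → Unique as → Unique (branches N b as)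
    branches-unique N b []                  = []
    branches-unique N b {a ∷ as} (a∉as ∷ as-unique) =
      ++⁺ (branch-unique N b a (b a)) (branches-unique N b as-unique) disjoint
      where
      disjoint : ∀ {x} → ¬ (x ∈ branch N b a (b a) × x ∈ branches N b as)
      disjoint (x∈branch , x∈branches) with ∈-branch⁻ N b a (b a) x∈branch | ∈-branches⁻ N b as x∈branches
      ... | _ , refl , _ | a′ , a′∈ , x∈′ with ∈-branch⁻ N b a′ (b a′) x∈′
      ... | _ , a∷w≡ , _ = All.lookup a∉as a′∈ (∷-injectiveˡ a∷w≡)

  degree-branches-vanish : ∀ j w N b as → (∀ {a} → a ∈ as → degree j w (branch N b a (b a)) ≡ 0) →
                           degree j w (branches N b as) ≡ 0
  degree-branches-vanish j w N b []       _      = refl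
  degree-branches-vanish j w N b (a ∷ as) vanish = trans (degree-++ j w (branch N b a (b a)) (branches N b as))
    (cong₂ _+_ (vanish (here refl)) (degree-branches-vanish j w N b as (vanish ∘ there)))

  degree-branches-single : ∀ j w N b {a as} → (∀ {a′} → a′ ≢ a → degree j w (branch N b a′ (b a′)) ≡ 0) →
                           Unique as → a ∈ as → degree j w (branches N b as) ≡ degree j w (branch N b a (b a))
  degree-branches-single j w N b {a} {_ ∷ as} others (a∉as ∷ _) (here refl) = begin
    degree j w (branch N b a (b a) ++ branches N b as)              ≡⟨ degree-++ j w (branch N b a (b a)) (branches N b as) ⟩
    degree j w (branch N b a (b a)) + degree j w (branches N b as) ≡⟨ cong (_ +_) rest-vanishes ⟩
    degree j w (branch N b a (b a)) + 0                            ≡⟨ +-identityʳ _ ⟩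
    degree j w (branch N b a (b a))                                ∎
    where
    open ≡-Reasoning
    rest-vanishes : degree j w (branches N b as) ≡ 0
    rest-vanishes = degree-branches-vanish j w N b as (λ a′∈ → others (λ a′≡a → All.lookup a∉as a′∈ (sym a′≡a)))
  degree-branches-single j w N b {a} {a″ ∷ as} others (a″∉as ∷ as-unique) (there a∈) =
    trans (degree-++ j w (branch N b a″ (b a″)) (branches N b as))
      (cong₂ _+_ (others (All.lookup a″∉as a∈)) (degree-branches-single j w N b others as-unique a∈))

  degree-[]-words : ∀ j N b → degree j [] (words (suc N) b) ≡ degree j [] (branch N b j (b j))
  degree-[]-words j N b = degree-branches-single j [] N b (λ {a′} a′≢j → vanish a′≢j (b a′)) (allFin⁺ c) (∈-allFin j)
    where
    vanish : ∀ {a′} → a′ ≢ j → ∀ k → degree j [] (branch N b a′ k) ≡ 0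
    vanish a′≢j zero          = refl
    vanish {a′} a′≢j (suc _) =
      trans (degree-[]-map-∷ j a′ (words N (spend b a′))) (cong (_* length (words N (spend b a′))) (indicator-≢ a′≢j))

  degree-[]-words-length : ∀ j N b {k} → b j ≡ suc k → degree j [] (words (suc N) b) ≡ length (words N (spend b j))
  degree-[]-words-length j N b bj≡ = begin
    degree j [] (words (suc N) b)                      ≡⟨ degree-[]-words j N b ⟩
    degree j [] (branch N b j (b j))                   ≡⟨ cong (degree j [] ∘ branch N b j) bj≡ ⟩
    degree j [] (map (j ∷_) (words N (spend b j)))     ≡⟨ degree-[]-map-∷ j j (words N (spend b j)) ⟩
    indicator j j * length (words N (spend b j))       ≡⟨ cong (_* length (words N (spend b j))) (indicator-refl j) ⟩
    1 * length (words N (spend b j))                   ≡⟨ *-identityˡ _ ⟩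
    length (words N (spend b j))                       ∎
    where open ≡-Reasoning

  degree-∷-words : ∀ j a w N b {k} → b a ≡ suc k →
                   degree j (a ∷ w) (words (suc N) b) ≡ indicator a j + degree j w (words N (spend b a))
  degree-∷-words j a w N b ba≡ = begin
    degree j (a ∷ w) (words (suc N) b)                                  ≡⟨ countEq-∷ j a (map (prefixColour (a ∷ w)) (branches N b (allFin c))) ⟩
    indicator a j + degree j (a ∷ w) (branches N b (allFin c))          ≡⟨ cong (indicator a j +_) only-branch-a ⟩
    indicator a j + degree j (a ∷ w) (branch N b a (b a))               ≡⟨ cong (λ k → indicator a j + degree j (a ∷ w) (branch N b a k)) ba≡ ⟩
    indicator a j + degree j (a ∷ w) (map (a ∷_) (words N (spend b a))) ≡⟨ cong (indicator a j +_) (degree-∷-map-∷ j a w (words N (spend b a))) ⟩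
    indicator a j + degree j w (words N (spend b a))                    ∎
    where
    open ≡-Reasoning
    vanish : ∀ {a′} → a′ ≢ a → ∀ k → degree j (a ∷ w) (branch N b a′ k) ≡ 0
    vanish a′≢a zero         = refl
    vanish {a′} a′≢a (suc _) = degree-∷-map-∷-≢ j w (words N (spend b a′)) (a′≢a ∘ sym)
    only-branch-a : degree j (a ∷ w) (branches N b (allFin c)) ≡ degree j (a ∷ w) (branch N b a (b a))
    only-branch-a = degree-branches-single j (a ∷ w) N b (λ {a′} a′≢a → vanish a′≢a (b a′)) (allFin⁺ c) (∈-allFin a)

  degree-words-≥ : ∀ N b → total b ≤ N → ∀ {w} → w ∈ words N b → ∀ j → b j ≤ degree j w (words N b)
  degree-words-≥ zero    b total≤0 (here refl) j = ≤-trans (entry≤total b j) total≤0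
  degree-words-≥ (suc N) b total≤ {[]} _ j with b j in bj≡
  ... | zero  = z≤n
  ... | suc k = begin
    suc k                          ≡⟨ cong suc (spend-self b j bj≡) ⟨
    suc (spend b j j)              ≤⟨ budget<length-words N (spend b j) j spend≤N ⟩
    length (words N (spend b j))   ≡⟨ degree-[]-words-length j N b bj≡ ⟨
    degree j [] (words (suc N) b)  ∎
    where
    open ≤-Reasoning
    spend≤N : spend b j j ≤ N
    spend≤N = ≤-trans (entry≤total (spend b j) j) (total-spend-≤ b j bj≡ total≤)
  degree-words-≥ (suc N) b total≤ {a ∷ w} aw∈ j with ∷∈words⁻ N b aw∈
  ... | (_ , ba≡) , w∈ = begin
    b j                                              ≡⟨ indicator+spend b a j ba≡ ⟨
    indicator a j + spend b a j                      ≤⟨ +-monoʳ-≤ (indicator a j) (degree-words-≥ N (spend b a) (total-spend-≤ b a ba≡ total≤) w∈ j) ⟩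
    indicator a j + degree j w (words N (spend b a)) ≡⟨ degree-∷-words j a w N b ba≡ ⟨
    degree j (a ∷ w) (words (suc N) b)               ∎
    where open ≤-Reasoning

  degree-words-exhausted : ∀ N b {w} → w ∈ words N b → ∀ j → letterCount j w ≡ b j → degree j w (words N b) ≡ b j
  degree-words-exhausted zero    b (here refl) j 0≡bj = 0≡bj
  degree-words-exhausted (suc N) b {[]} _ j 0≡bj = begin
    degree j [] (words (suc N) b)    ≡⟨ degree-[]-words j N b ⟩
    degree j [] (branch N b j (b j)) ≡⟨ cong (degree j [] ∘ branch N b j) 0≡bj ⟨
    0                                ≡⟨ 0≡bj ⟩
    b j                              ∎
    where open ≡-Reasoning
  degree-words-exhausted (suc N) b {a ∷ w} aw∈ j count≡ with ∷∈words⁻ N b aw∈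
  ... | (_ , ba≡) , w∈ = begin
    degree j (a ∷ w) (words (suc N) b)               ≡⟨ degree-∷-words j a w N b ba≡ ⟩
    indicator a j + degree j w (words N (spend b a)) ≡⟨ cong (indicator a j +_) (degree-words-exhausted N (spend b a) w∈ j count≡′) ⟩
    indicator a j + spend b a j                      ≡⟨ indicator+spend b a j ba≡ ⟩
    b j                                              ∎
    where
    open ≡-Reasoning
    count≡′ : letterCount j w ≡ spend b a j
    count≡′ = +-cancelˡ-≡ (indicator a j) _ _ (begin
      indicator a j + letterCount j w ≡⟨ countEq-∷ j a (map just w) ⟨
      letterCount j (a ∷ w)           ≡⟨ count≡ ⟩
      b j                             ≡⟨ indicator+spend b a j ba≡ ⟨
      indicator a j + spend b a j     ∎)

mainTheorem1 : (c : ℕ) → 2 ≤ c → (d : ℕ) → 1 ≤ d →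
    Σ (ColoredGraph c) (λ G → MinMonoDegreeIs G d × ¬ ProperlyColouredCycle G)
mainTheorem1 zero     () d _
mainTheorem1 (suc c′) _  d _ =
  prefixGraph L , (d≤degree , attained) , prefixGraph-noProperCycle L (words-unique N budget)
  where
  budget : Vector ℕ (suc c′)
  budget _ = d
  N : ℕ
  N = total budget
  L : List (Word (suc c′))
  L = words N budget

  d≤degree : ∀ x j → d ≤ colourDegree (prefixGraph L) j x
  d≤degree x j = subst (d ≤_) (sym (colourDegree-prefixGraph L j x)) (degree-words-≥ N budget ≤-refl (∈-lookup x) j)

  0ᵈ∈L : replicate d zero ∈ L
  0ᵈ∈L = replicate∈words zero d ≤-refl (entry≤total budget zero)

  attained : Σ (Fin (length L)) λ x → Σ (Fin (suc c′)) λ j → colourDegree (prefixGraph L) j x ≡ d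
  attained = index 0ᵈ∈L , zero , (begin
    colourDegree (prefixGraph L) zero (index 0ᵈ∈L) ≡⟨ colourDegree-prefixGraph L zero (index 0ᵈ∈L) ⟩
    degree zero (lookup L (index 0ᵈ∈L)) L          ≡⟨ cong (λ w → degree zero w L) (lookup-index 0ᵈ∈L) ⟨
    degree zero (replicate d zero) L               ≡⟨ degree-words-exhausted N budget 0ᵈ∈L zero (letterCount-replicate zero d) ⟩
    d                                              ∎)
    where open ≡-Reasoning
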